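{- Strong rectangularity does not imply strong balance: there is a finite set $D$ and a constraint language $\Gamma$ on $D$ that is strongly rectangular but not strongly balanced.
   Context: A constraint language on $D$ is a finite set of finitary relations on $D$ containing equality. A relation is pp-definable over $\Gamma$ if definable from relations of $\Gamma$ by conjunction and existential quantification (variables may repeat). A binary relation $B\subseteq A_1\times A_2$ is rectangular if $(a,c),(a,d),(b,c)\in B$ implies $(b,d)\in B$; $R\subseteq D^n$ ($n\ge2$) is rectangular if it is rectangular as a binary relation on $D^k\times D^{n-k}$ for each $1\le k<n$; $\Gamma$ is strongly rectangular if every pp-definable relation of arity $\ge2$ is rectangular. A matrix $f\colon A_1\times A_2\to\mathbb{Q}_{\ge0}$ is a rank-one block matrix if its underlying relation $\{(x,y):f(x,y)>0\}$ is rectangular and each block (submatrix on a connected component of the bipartite support graph) has rank one. $R\subseteq D^n$, $n\ge3$, is balanced if for all $k,\ell\ge1$ with $k+\ell<n$ the matrix $M(x,y)=|\{z\in D^{n-k-\ell}:(x,y,z)\in R\}|$ ($x\in D^k,y\in D^\ell$) is a rank-one block matrix. $\Gamma$ is strongly balanced if every pp-definable relation of arity $\ge3$ is balanced. -}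

module Defs where

open import Data.Nat using (ℕ; zero; suc; _+_; _≥_; _<_; _<ᵇ_)
open import Data.Fin using (Fin) renaming (_≟_ to _≟ᶠ_)
import Data.Fin as F
open import Data.Bool using (Bool; T)
open import Data.List using (List; []; _∷_; length; lookup; concatMap; map; filterᵇ)
open import Data.Bool.ListAction using (any; all)
open import Data.List.Relation.Unary.Any using (Any)
open import Data.Vec.Functional using () renaming (_∷_ to _∷ᵛ_; _++_ to _++ᵛ_)
open import Data.Product using (Σ; ∃; _×_; _,_; proj₁; proj₂)
open import Data.Sum using (_⊎_; inj₁; inj₂)
open import Data.Empty using (⊥)
open import Data.Integer using (+_)
open import Data.Rational using (ℚ; _/_; _*_)
open import Relation.Binary.PropositionalEquality using (_≡_)
open import Relation.Binary.Construct.Closure.ReflexiveTransitive using (Star)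
open import Relation.Nullary.Decidable using (⌊_⌋)

Rel : ℕ → ℕ → Set
Rel d n = (Fin n → Fin d) → Bool

allTuples : (n d : ℕ) → List (Fin n → Fin d)
allTuples zero    d = (λ ()) ∷ []
allTuples (suc n) d =
  concatMap (λ a → map (λ t → a ∷ᵛ t) (allTuples n d)) (Data.List.allFin d)
  where import Data.List

EqRel : (d : ℕ) → Rel d 2
EqRel d t = ⌊ t F.zero ≟ᶠ t (F.suc F.zero) ⌋

RelList : ℕ → Set
RelList d = List (Σ ℕ (Rel d))

IsEqRel : {d : ℕ} → Σ ℕ (Rel d) → Set
IsEqRel {d} (suc (suc zero) , R) = ∀ t → R t ≡ EqRel d t
IsEqRel _ = ⊥

record ConstraintLanguage (d : ℕ) : Set where
  field
    rels     : RelList d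
    hasEqual : Any IsEqRel rels
open ConstraintLanguage public

-- Primitive-positive definitions
-- A pp-formula with n free variables: ∃ (m existential variables).
-- conjunction of atoms R(v₁,…,v_r) with R ∈ Γ and the vᵢ among the
-- n + m variables (repetitions allowed).

arityOf : {d : ℕ} (Γ : ConstraintLanguage d) → Fin (length (rels Γ)) → ℕ
arityOf Γ i = proj₁ (lookup (rels Γ) i)

relOf : {d : ℕ} (Γ : ConstraintLanguage d) (i : Fin (length (rels Γ))) →
        Rel d (arityOf Γ i)
relOf Γ i = proj₂ (lookup (rels Γ) i)

record Atom {d : ℕ} (Γ : ConstraintLanguage d) (v : ℕ) : Set where
  field
    rel  : Fin (length (rels Γ))
    args : Fin (arityOf Γ rel) → Fin v
open Atom public

record PPFormula {d : ℕ} (Γ : ConstraintLanguage d) (n : ℕ) : Set where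
  field
    nExist : ℕ
    atoms  : List (Atom Γ (n + nExist))
open PPFormula public

⟦_⟧ : {d : ℕ} {Γ : ConstraintLanguage d} {n : ℕ} → PPFormula Γ n → Rel d n
⟦_⟧ {d} {Γ} φ t =
  any (λ w → all (λ a → relOf Γ (rel a) (λ j → (t ++ᵛ w) (args a j))) (atoms φ))
      (allTuples (nExist φ) d)

RectangularB : {A₁ A₂ : Set} → (A₁ → A₂ → Bool) → Set
RectangularB {A₁} {A₂} B =
  ∀ (a b : A₁) (c e : A₂) → T (B a c) → T (B a e) → T (B b c) → T (B b e)

-- Γ is strongly rectangular: every pp-definable relation of arity n ≥ 2 is
-- rectangular w.r.t. every split D^k × D^(n-k), 1 ≤ k < n
-- (written here with n = k + m, k ≥ 1, m ≥ 1).
StronglyRectangular : {d : ℕ} → ConstraintLanguage d → Set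
StronglyRectangular {d} Γ =
  ∀ (k m : ℕ) → k ≥ 1 → m ≥ 1 → (φ : PPFormula Γ (k + m)) →
  RectangularB {Fin k → Fin d} {Fin m → Fin d} (λ x y → ⟦ φ ⟧ (x ++ᵛ y))

ℕtoℚ : ℕ → ℚ
ℕtoℚ n = + n / 1

SupportEdge : {A₁ A₂ : Set} → (A₁ → A₂ → ℕ) → A₁ ⊎ A₂ → A₁ ⊎ A₂ → Set
SupportEdge M (inj₁ a) (inj₂ c) = 0 < M a c
SupportEdge M (inj₂ c) (inj₁ a) = 0 < M a c
SupportEdge M _ _ = ⊥

Connected : {A₁ A₂ : Set} → (A₁ → A₂ → ℕ) → A₁ ⊎ A₂ → A₁ ⊎ A₂ → Set
Connected M = Star (SupportEdge M)

-- M is a rank-one block matrix: its support is rectangular and, for every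
-- connected component K (represented by any vertex v of it), the submatrix on
-- the rows and columns in K has rank one, i.e. is an outer product u vᵀ.
RankOneBlock : {A₁ A₂ : Set} → (A₁ → A₂ → ℕ) → Set
RankOneBlock {A₁} {A₂} M =
  RectangularB (λ a c → 0 <ᵇ M a c) ×
  (∀ (v : A₁ ⊎ A₂) → ∃ λ (u : A₁ → ℚ) → ∃ λ (w : A₂ → ℚ) →
     ∀ a c → Connected M v (inj₁ a) → Connected M v (inj₂ c) →
     ℕtoℚ (M a c) ≡ u a * w c)

count : {r d : ℕ} → Rel d r → ℕ
count {r} {d} P = length (filterᵇ P (allTuples r d))

-- R of arity n = k + l + r (k, l, r ≥ 1, i.e. k + l < n) is balanced:
-- M(x,y) = |{z ∈ D^r : (x,y,z) ∈ R}| is a rank-one block matrix.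
Balanced : {d n : ℕ} → Rel d n → Set
Balanced {d} {n} R =
  ∀ (k l r : ℕ) → k ≥ 1 → l ≥ 1 → r ≥ 1 → (e : (k + l) + r ≡ n) →
  RankOneBlock {Fin k → Fin d} {Fin l → Fin d}
    (λ x y → count {r} (λ z → R (λ i → ((x ++ᵛ y) ++ᵛ z) (castF e i))))
  where
  castF : {a b : ℕ} → a ≡ b → Fin b → Fin a
  castF Relation.Binary.PropositionalEquality.refl i = i

StronglyBalanced : {d : ℕ} → ConstraintLanguage d → Set
StronglyBalanced Γ = ∀ (n : ℕ) → n ≥ 3 → (φ : PPFormula Γ n) → Balanced ⟦ φ ⟧

-- A language with a Maltsev polymorphism is strongly rectangular, because
-- polymorphisms are inherited by pp-definable relations and rectangularity is
-- preservation by a Maltsev operation. Take D = ℤ₂² with the point (1, 1)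
-- doubled, and the Maltsev operation that is the affine map x + y + z of ℤ₂²
-- read through the labelling D → ℤ₂² (away from the trivial cases x = y,
-- y = z). It preserves R(x, y, z) :⇔ (x, y) = label z, with x, y ∈ {0, 1}.
-- Counting z over (x, y) gives the matrix [[1, 1], [1, 2]], a single
-- connected block of rank two, so R is not balanced.
module Submission where

open import Defs
open import Data.Nat using (ℕ; zero; suc; _+_; _<_; s≤s; z≤n)
open import Data.Fin using (Fin; splitAt) renaming (_≟_ to _≟ᶠ_)
import Data.Fin as F
open import Data.Bool using (Bool; true; false; T; _∧_; _xor_)
open import Data.Bool.Properties using (T-∧; xor-same; xor-assoc; xor-identityʳ)
open import Data.Bool.ListAction using (all)
open import Data.List using ([]; _∷_)
open import Data.List.Relation.Unary.Any as Any using (Any; here; satisfied)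
open import Data.List.Relation.Unary.Any.Properties using (concatMap⁺; map⁺; any⁺; any⁻)
open import Data.List.Relation.Unary.All as All using (All)
open import Data.List.Relation.Unary.All.Properties using (all⁺; all⁻)
open import Data.List.Membership.Propositional.Properties using (∈-allFin)
open import Data.Vec.Functional using (tail) renaming (_∷_ to _∷ᵛ_; _++_ to _++ᵛ_)
open import Data.Product using (∃; _×_; _,_; proj₁; proj₂)
open import Data.Sum using (inj₁; inj₂)
open import Data.Rational using (ℚ; _*_)
open import Data.Rational.Properties using (*-comm; *-1-commutativeMonoid)
open import Algebra.Bundles using (CommutativeMonoid)
import Algebra.Properties.CommutativeSemigroup as CommutativeSemigroupProperties
open import Function using (_∘_; id)
open import Function.Bundles using (Equivalence)
open import Relation.Binary.PropositionalEquality
open import Relation.Binary.Construct.Closure.ReflexiveTransitive using (ε; _◅_)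
open import Relation.Nullary using (¬_; yes; no; contradiction)
open import Relation.Nullary.Decidable using (⌊_⌋; toWitness; fromWitness)

private
  variable
    d n : ℕ

allTuples-complete : ∀ n d (t : Fin n → Fin d) → Any (_≗ t) (allTuples n d)
allTuples-complete zero    d t = here (λ ())
allTuples-complete (suc n) d t =
  concatMap⁺ _ (Any.map (λ t₀≡a → map⁺ (Any.map (cons-≗ (sym t₀≡a))
                                                (allTuples-complete n d (tail t))))
                      (∈-allFin (t F.zero)))
  where
  cons-≗ : ∀ {a u} → a ≡ t F.zero → u ≗ tail t → (a ∷ᵛ u) ≗ t
  cons-≗ a≡ u≗ F.zero    = a≡
  cons-≗ a≡ u≗ (F.suc i) = u≗ i

Op : ℕ → Set
Op d = Fin d → Fin d → Fin d → Fin d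

_⟨_,_,_⟩ : {A : Set} → Op d → (A → Fin d) → (A → Fin d) → (A → Fin d) → A → Fin d
(m ⟨ s₁ , s₂ , s₃ ⟩) j = m (s₁ j) (s₂ j) (s₃ j)

-- Relations are arbitrary Boolean functions that need not respect ≗, so the
-- image tuple is only required to agree pointwise with m ⟨ s₁ , s₂ , s₃ ⟩.
Polymorphism : Op d → Rel d n → Set
Polymorphism m R = ∀ s₁ s₂ s₃ s → s ≗ m ⟨ s₁ , s₂ , s₃ ⟩ →
  T (R s₁) → T (R s₂) → T (R s₃) → T (R s)

++-⟨⟩ : ∀ {k l} (m : Op d) {s₁ s₂ s₃ s : Fin k → Fin d} {w₁ w₂ w₃ w : Fin l → Fin d} →
  s ≗ m ⟨ s₁ , s₂ , s₃ ⟩ → w ≗ m ⟨ w₁ , w₂ , w₃ ⟩ →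
  (s ++ᵛ w) ≗ m ⟨ s₁ ++ᵛ w₁ , s₂ ++ᵛ w₂ , s₃ ++ᵛ w₃ ⟩
++-⟨⟩ {k = k} m s≗ w≗ i with splitAt k i
... | inj₁ j = s≗ j
... | inj₂ j = w≗ j

module _ {Γ : ConstraintLanguage d} {m : Op d}
         (polymorphism : ∀ i → Polymorphism m (relOf Γ i)) where

  ⟦⟧-polymorphism : (φ : PPFormula Γ n) → Polymorphism m ⟦ φ ⟧
  ⟦⟧-polymorphism {n} φ s₁ s₂ s₃ s s≗ R₁ R₂ R₃ =
    any⁺ _ (Any.map extend (allTuples-complete (nExist φ) d (m ⟨ w₁ , w₂ , w₃ ⟩)))
    where
    satisfies : (Fin n → Fin d) → (Fin (nExist φ) → Fin d) → Atom Γ (n + nExist φ) → Bool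
    satisfies t w a = relOf Γ (rel a) ((t ++ᵛ w) ∘ args a)

    witness : ∀ {t} → T (⟦ φ ⟧ t) → ∃ λ w → All (T ∘ satisfies t w) (atoms φ)
    witness {t} R =
      let w , sat = satisfied (any⁻ (λ w → all (satisfies t w) (atoms φ)) (allTuples _ d) R)
      in w , all⁺ (satisfies t w) (atoms φ) sat

    w₁ w₂ w₃ : Fin (nExist φ) → Fin d
    w₁ = proj₁ (witness R₁)
    w₂ = proj₁ (witness R₂)
    w₃ = proj₁ (witness R₃)

    extend : ∀ {w} → w ≗ m ⟨ w₁ , w₂ , w₃ ⟩ → T (all (satisfies s w) (atoms φ))
    extend {w} w≗ = all⁻ (satisfies s w) (All.zipWith
      (λ {a} ((a₁ , a₂) , a₃) → polymorphism (rel a) _ _ _ _ (++-⟨⟩ m s≗ w≗ ∘ args a) a₁ a₂ a₃)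
      (All.zip (proj₂ (witness R₁) , proj₂ (witness R₂)) , proj₂ (witness R₃)))

record IsMaltsev (m : Op d) : Set where
  field
    identityˡ : ∀ x y → m x x y ≡ y
    identityʳ : ∀ x y → m x y y ≡ x

-- Rectangularity is the special case of preservation by a Maltsev operation
-- applied to the tuples (a, e), (a, c), (b, c).
maltsev⇒stronglyRectangular : {Γ : ConstraintLanguage d} {m : Op d} → IsMaltsev m →
  (∀ i → Polymorphism m (relOf Γ i)) → StronglyRectangular Γ
maltsev⇒stronglyRectangular {m = m} maltsev polymorphism k _ _ _ φ a b c e ac ae bc =
  ⟦⟧-polymorphism {m = m} polymorphism φ _ _ _ _ be≗ ae ac bc
  where
  open IsMaltsev maltsev
  be≗ : (b ++ᵛ e) ≗ m ⟨ a ++ᵛ e , a ++ᵛ c , b ++ᵛ c ⟩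
  be≗ i with splitAt k i
  ... | inj₁ j = sym (identityˡ (a j) (b j))
  ... | inj₂ j = sym (identityʳ (e j) (c j))

Graph : (Fin d → Fin d) → Fin n → Fin n → Rel d n
Graph f i j t = ⌊ t i ≟ᶠ f (t j) ⌋

_∩_ : Rel d n → Rel d n → Rel d n
(R ∩ S) t = R t ∧ S t

graph-polymorphism : {m : Op d} {f : Fin d → Fin d} →
  (∀ x y z → f (m x y z) ≡ m (f x) (f y) (f z)) →
  (i j : Fin n) → Polymorphism m (Graph f i j)
graph-polymorphism {m = m} {f} f-hom i j s₁ s₂ s₃ s s≗ G₁ G₂ G₃ =
  fromWitness (begin
    s i                                ≡⟨ s≗ i ⟩
    m (s₁ i) (s₂ i) (s₃ i)             ≡⟨ cong₂ (λ x y → m x y (s₃ i)) (toWitness G₁) (toWitness G₂) ⟩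
    m (f (s₁ j)) (f (s₂ j)) (s₃ i)     ≡⟨ cong (m _ _) (toWitness G₃) ⟩
    m (f (s₁ j)) (f (s₂ j)) (f (s₃ j)) ≡⟨ f-hom (s₁ j) (s₂ j) (s₃ j) ⟨
    f (m (s₁ j) (s₂ j) (s₃ j))         ≡⟨ cong f (s≗ j) ⟨
    f (s j)                            ∎)
  where open ≡-Reasoning

∩-polymorphism : {m : Op d} {R S : Rel d n} →
  Polymorphism m R → Polymorphism m S → Polymorphism m (R ∩ S)
∩-polymorphism {R = R} {S} R-pol S-pol s₁ s₂ s₃ s s≗ RS₁ RS₂ RS₃ =
  let r₁ , t₁ = split RS₁ ; r₂ , t₂ = split RS₂ ; r₃ , t₃ = split RS₃
  in Equivalence.from T-∧ (R-pol s₁ s₂ s₃ s s≗ r₁ r₂ r₃ , S-pol s₁ s₂ s₃ s s≗ t₁ t₂ t₃)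
  where
  split : ∀ {t} → T ((R ∩ S) t) → T (R t) × T (S t)
  split {t} = Equivalence.to (T-∧ {R t})

EqRel-polymorphism : {m : Op d} → Polymorphism m (EqRel d)
EqRel-polymorphism {m = m} = graph-polymorphism {m = m} {f = id} (λ _ _ _ → refl) F.zero (F.suc F.zero)

RankOneBlock-minor : {A₁ A₂ : Set} {M : A₁ → A₂ → ℕ} → RankOneBlock M →
  ∀ {a b c e} → 0 < M a c → 0 < M a e → 0 < M b c →
  ℕtoℚ (M a c) * ℕtoℚ (M b e) ≡ ℕtoℚ (M a e) * ℕtoℚ (M b c)
RankOneBlock-minor {M = M} (_ , rank-one) {a} {b} {c} {e} ac ae bc
  with rank-one (inj₁ a)
... | u , w , M≡ = begin
  ℕtoℚ (M a c) * ℕtoℚ (M b e) ≡⟨ cong₂ _*_ (M≡ a c ε (ac ◅ ε)) (M≡ b e a~b (ae ◅ ε)) ⟩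
  (u a * w c) * (u b * w e)   ≡⟨ interchange (u a) (w c) (u b) (w e) ⟩
  (u a * u b) * (w c * w e)   ≡⟨ cong ((u a * u b) *_) (*-comm (w c) (w e)) ⟩
  (u a * u b) * (w e * w c)   ≡⟨ interchange (u a) (w e) (u b) (w c) ⟨
  (u a * w e) * (u b * w c)   ≡⟨ cong₂ _*_ (M≡ a e ε (ae ◅ ε)) (M≡ b c a~b (ac ◅ ε)) ⟨
  ℕtoℚ (M a e) * ℕtoℚ (M b c) ∎
  where
  open ≡-Reasoning
  open CommutativeSemigroupProperties (CommutativeMonoid.commutativeSemigroup *-1-commutativeMonoid)
  a~b : Connected M (inj₁ a) (inj₁ b)
  a~b = _◅_ {j = inj₂ c} ac (bc ◅ ε)

pattern 0F = F.zero
pattern 1F = F.suc F.zero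
pattern 2F = F.suc (F.suc F.zero)
pattern 3F = F.suc (F.suc (F.suc F.zero))
pattern 4F = F.suc (F.suc (F.suc (F.suc F.zero)))

_⊕_ : Bool × Bool → Bool × Bool → Bool × Bool
u ⊕ v = (proj₁ u xor proj₁ v , proj₂ u xor proj₂ v)

xor-cancelʳ : ∀ p q → (p xor q) xor q ≡ p
xor-cancelʳ p q = begin
  (p xor q) xor q ≡⟨ xor-assoc p q q ⟩
  p xor (q xor q) ≡⟨ cong (p xor_) (xor-same q) ⟩
  p xor false     ≡⟨ xor-identityʳ p ⟩
  p               ∎
  where open ≡-Reasoning

⊕-cancelˡ : ∀ u v → (u ⊕ u) ⊕ v ≡ v
⊕-cancelˡ (p , q) (p′ , q′) = cong₂ _,_ (cong (_xor p′) (xor-same p)) (cong (_xor q′) (xor-same q))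

⊕-cancelʳ : ∀ u v → (u ⊕ v) ⊕ v ≡ u
⊕-cancelʳ (p , q) (p′ , q′) = cong₂ _,_ (xor-cancelʳ p p′) (xor-cancelʳ q q′)

label : Fin 5 → Bool × Bool
label 0F = false , false
label 1F = false , true
label 2F = true  , false
label 3F = true  , true
label 4F = true  , true

code : Bool × Bool → Fin 5
code (false , false) = 0F
code (false , true)  = 1F
code (true  , false) = 2F
code (true  , true)  = 3F

label-code : ∀ v → label (code v) ≡ v
label-code (false , false) = refl
label-code (false , true)  = refl
label-code (true  , false) = refl
label-code (true  , true)  = refl

bit : Bool → Fin 5
bit false = 0F
bit true  = 1F

maltsev : Op 5
maltsev a b c with a ≟ᶠ b | b ≟ᶠ c
... | yes _ | _     = c
... | no _  | yes _ = a
... | no _  | no _  = code ((label a ⊕ label b) ⊕ label c)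

maltsev-isMaltsev : IsMaltsev maltsev
maltsev-isMaltsev = record { identityˡ = identityˡ ; identityʳ = identityʳ }
  where
  identityˡ : ∀ x y → maltsev x x y ≡ y
  identityˡ x y with x ≟ᶠ x | x ≟ᶠ y
  ... | yes _  | _ = refl
  ... | no x≢x | _ = contradiction refl x≢x
  identityʳ : ∀ x y → maltsev x y y ≡ x
  identityʳ x y with x ≟ᶠ y | y ≟ᶠ y
  ... | yes x≡y | _      = sym x≡y
  ... | no _    | yes _  = refl
  ... | no _    | no y≢y = contradiction refl y≢y

label-maltsev : ∀ a b c → label (maltsev a b c) ≡ (label a ⊕ label b) ⊕ label c
label-maltsev a b c with a ≟ᶠ b | b ≟ᶠ c
... | yes refl | _    = sym (⊕-cancelˡ (label a) (label c))
... | no _  | yes refl = sym (⊕-cancelʳ (label a) (label b))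
... | no _  | no _     = label-code _

bit-maltsev : ∀ p q r → bit ((p xor q) xor r) ≡ maltsev (bit p) (bit q) (bit r)
bit-maltsev false false false = refl
bit-maltsev false false true  = refl
bit-maltsev false true  false = refl
bit-maltsev false true  true  = refl
bit-maltsev true  false false = refl
bit-maltsev true  false true  = refl
bit-maltsev true  true  false = refl
bit-maltsev true  true  true  = refl

bit∘-maltsev : (ρ : Fin 5 → Bool) → (∀ a b c → ρ (maltsev a b c) ≡ (ρ a xor ρ b) xor ρ c) →
  ∀ a b c → bit (ρ (maltsev a b c)) ≡ maltsev (bit (ρ a)) (bit (ρ b)) (bit (ρ c))
bit∘-maltsev ρ ρ-maltsev a b c = trans (cong bit (ρ-maltsev a b c)) (bit-maltsev (ρ a) (ρ b) (ρ c))

first second : Fin 5 → Fin 5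
first  = bit ∘ proj₁ ∘ label
second = bit ∘ proj₂ ∘ label

R : Rel 5 3
R = Graph first 0F 2F ∩ Graph second 1F 2F

R-polymorphism : Polymorphism maltsev R
R-polymorphism =
  ∩-polymorphism {m = maltsev} {R = Graph first 0F 2F} {S = Graph second 1F 2F}
    (graph-polymorphism {m = maltsev} {f = first}
      (bit∘-maltsev (proj₁ ∘ label) (λ a b c → cong proj₁ (label-maltsev a b c))) 0F 2F)
    (graph-polymorphism {m = maltsev} {f = second}
      (bit∘-maltsev (proj₂ ∘ label) (λ a b c → cong proj₂ (label-maltsev a b c))) 1F 2F)

Γ : ConstraintLanguage 5
Γ = record { rels = (2 , EqRel 5) ∷ (3 , R) ∷ [] ; hasEqual = here (λ _ → refl) }

Γ-polymorphism : ∀ i → Polymorphism maltsev (relOf Γ i)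
Γ-polymorphism 0F = EqRel-polymorphism {m = maltsev}
Γ-polymorphism 1F = R-polymorphism

R-formula : PPFormula Γ 3
R-formula = record { nExist = 0 ; atoms = record { rel = 1F ; args = id } ∷ [] }

R-counts : (Fin 1 → Fin 5) → (Fin 1 → Fin 5) → ℕ
R-counts x y = count {1} (λ z → ⟦ R-formula ⟧ ((x ++ᵛ y) ++ᵛ z))

¬stronglyBalanced : ¬ StronglyBalanced Γ
¬stronglyBalanced balanced = 1·2≢1·1 (RankOneBlock-minor R-counts-rankOne
  {a = λ _ → 0F} {b = λ _ → 1F} {c = λ _ → 0F} {e = λ _ → 1F} 0<1 0<1 0<1)
  where
  0<1 : 0 < 1
  0<1 = s≤s z≤n
  R-counts-rankOne : RankOneBlock R-counts
  R-counts-rankOne = balanced 3 (s≤s (s≤s (s≤s z≤n))) R-formula 1 1 1 0<1 0<1 0<1 refl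
  1·2≢1·1 : ℕtoℚ 1 * ℕtoℚ 2 ≢ ℕtoℚ 1 * ℕtoℚ 1
  1·2≢1·1 eq with cong ℚ.numerator eq
  ... | ()

lemma7p3 : ∃ λ (d : ℕ) → ∃ λ (Γ : ConstraintLanguage d) →
    StronglyRectangular Γ × ¬ StronglyBalanced Γ
lemma7p3 = 5 , Γ , maltsev⇒stronglyRectangular maltsev-isMaltsev Γ-polymorphism , ¬stronglyBalanced
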